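{- Let $G=(V,E)$ be a connected graph with a $(3,2)$-cover and $|V|>4$. Suppose $G$ has an edge $e$ that is not contained in any copy of $K_4$. Then the graph $G.e=(V',E')$ is a connected graph with a $(3,2)$-cover, and $|V'|=|V|-1$ and $|E'|\le |E|-3$.
   Context: A graph $G$ has a $(k,\ell)$-cover if every edge of $G$ lies in at least $\ell$ copies of $K_k$; a $(3,2)$-cover means every edge lies in at least two triangles. For an edge $e=uv$ of a simple graph $G$, $G.e$ denotes the simple graph obtained from $G$ by deleting $e$, identifying $u$ and $v$ into a single new vertex $u_v$, and replacing any resulting multiple edges by single edges (no loops arise since $e$ is deleted). -}

module Defs where

open import Data.Bool using (Bool; true; false; T; _∧_; not; if_then_else_)
open import Data.Nat using (ℕ; zero; suc; _<ᵇ_)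
open import Data.Fin using (Fin; toℕ; punchOut; _≟_)
open import Data.Fin.Properties using (any?)
open import Data.List using (List; map; allFin)
open import Data.Nat.ListAction using (sum)
open import Data.Product using (Σ; ∃; _×_; _,_)
open import Relation.Binary.PropositionalEquality using (_≡_; _≢_)
open import Relation.Nullary using (¬_; yes; no; does)
open import Data.Bool using (T?)

Adj : ℕ → Set
Adj n = Fin n → Fin n → Bool

record IsSimple {n : ℕ} (adj : Adj n) : Set where
  field
    symmetric   : ∀ i j → adj i j ≡ adj j i
    irreflexive : ∀ i → adj i i ≡ false

Edge : ∀ {n} → Adj n → Fin n → Fin n → Set
Edge adj i j = T (adj i j)

data Walk {n : ℕ} (adj : Adj n) : Fin n → Fin n → Set where
  here : ∀ {i} → Walk adj i i
  step : ∀ {i j k} → Edge adj i j → Walk adj j k → Walk adj i k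

Connected : ∀ {n} → Adj n → Set
Connected {n} adj = ∀ (i j : Fin n) → Walk adj i j

numEdges : ∀ {n} → Adj n → ℕ
numEdges {n} adj =
  sum (map (λ i → sum (map (λ j → if (toℕ i <ᵇ toℕ j) ∧ adj i j then 1 else 0)
                           (allFin n)))
           (allFin n))

-- (3,2)-cover: every edge uv lies in at least two distinct triangles,
-- i.e. there are two distinct vertices w₁ ≠ w₂ each adjacent to both u and v.
Cover32 : ∀ {n} → Adj n → Set
Cover32 {n} adj =
  ∀ (u v : Fin n) → Edge adj u v →
    Σ (Fin n) λ w₁ → Σ (Fin n) λ w₂ →
      w₁ ≢ w₂ × Edge adj u w₁ × Edge adj v w₁ × Edge adj u w₂ × Edge adj v w₂

InK4 : ∀ {n} → Adj n → Fin n → Fin n → Set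
InK4 {n} adj u v =
  Σ (Fin n) λ w → Σ (Fin n) λ x →
    w ≢ x × Edge adj u v × Edge adj u w × Edge adj u x
          × Edge adj v w × Edge adj v x × Edge adj w x

-- The quotient map Fin (suc m) → Fin m: remove u (via punchOut) and send
-- u itself to the image of v.
contractMap : ∀ {m} (u v : Fin (suc m)) → u ≢ v → Fin (suc m) → Fin m
contractMap u v u≢v x with u ≟ x
... | yes _   = punchOut u≢v
... | no u≢x  = punchOut u≢x

-- a ~ b in G.e iff a ≠ b and some edge xy of G maps onto a, b.
-- (The edge e itself maps to a loop and is thus excluded; parallel
-- edges collapse since adjacency is a relation.)
contract : ∀ {m} (adj : Adj (suc m)) (u v : Fin (suc m)) → u ≢ v → Adj m
contract {m} adj u v u≢v a b =
  not (does (a ≟ b)) ∧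
  does (any? λ x → any? λ y →
          T? (does (contractMap u v u≢v x ≟ a) ∧ does (contractMap u v u≢v y ≟ b)
              ∧ adj x y))

{-# OPTIONS --safe #-}

-- Write φ for the contraction map and uᵥ for the merged vertex; φ is injective away from u and v.
-- An edge ab of G.e lifts to an edge xy of G with, say, y ∉ {u, v}. The two common neighbours
-- of x and y have distinct images, since otherwise they would be u and v and x, y, u, v would be
-- a K₄ through uv. These images are common neighbours of a and b, except when one of them is the
-- partner x̄ of x ∈ {u, v}, which collapses onto a; it is then replaced by a common neighbour of
-- x̄ and y other than x.
-- Counting edges: the edge uv disappears and for every common neighbour w of u and v the edges
-- uw and vw merge, so |E'| + 1 + |N(u) ∩ N(v)| ≤ |E|, while |N(u) ∩ N(v)| ≥ 2 by the cover of uv.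

module Submission where

open import Defs
open import Data.Bool using (Bool; true; false; T; _∧_; not; if_then_else_)
open import Data.Bool.Properties using (T-≡; T-∧; ⇔→≡)
open import Data.Empty using (⊥-elim)
open import Data.Fin using (Fin; zero; suc; toℕ; punchIn; punchOut; _≟_)
open import Data.Fin.Properties using (punchIn-punchOut; punchInᵢ≢i; punchIn-injective; toℕ-injective; any?)
open import Data.List using (tabulate; map; allFin)
open import Data.List.Properties using (map-tabulate)
open import Data.Nat using (ℕ; zero; suc; _+_; _*_; _≤_; _<_; _<ᵇ_; z≤n; s≤s)
open import Data.Nat.ListAction using () renaming (sum to listSum)
open import Data.Nat.Properties
  using ( +-0-commutativeMonoid; +-identityʳ; +-mono-≤; +-monoʳ-≤; *-cancelˡ-≤; ≤-refl; ≤-trans; ≤-antisym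
        ; m≤m+n; ≮⇒≥; <-asym; <ᵇ⇒<; <⇒<ᵇ; module ≤-Reasoning)
open import Data.Nat.Solver using (module +-*-Solver)
open import Data.Product using (Σ; _×_; _,_; ∃; ∃₂)
open import Data.Sum using (_⊎_; inj₁; inj₂; [_,_])
open import Data.Vec.Functional using (removeAt)
open import Function using (_∘_; Equivalence; mk⇔)
open import Relation.Binary.PropositionalEquality hiding ([_])
open import Relation.Nullary using (¬_; yes; no; does; Dec; ¬?; _×-dec_; _⊎-dec_)
open import Relation.Nullary.Decidable using (toWitness; fromWitness; isYes≗does; dec-true; T?)

open import Algebra.Properties.CommutativeMonoid.Sum +-0-commutativeMonoid

𝟙 : Bool → ℕ
𝟙 b = if b then 1 else 0

𝟙≤1 : ∀ b → 𝟙 b ≤ 1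
𝟙≤1 false = z≤n
𝟙≤1 true  = s≤s z≤n

T⇒1≤𝟙 : ∀ {b} → T b → 1 ≤ 𝟙 b
T⇒1≤𝟙 {true} _ = s≤s z≤n

𝟙-mono : ∀ {x y} → (T x → T y) → 𝟙 x ≤ 𝟙 y
𝟙-mono {false} _   = z≤n
𝟙-mono {true}  x⇒y = T⇒1≤𝟙 (x⇒y _)

𝟙-∧-+-≤ : ∀ {x y z} → (T z → T x ⊎ T y) → 𝟙 (x ∧ y) + 𝟙 z ≤ 𝟙 x + 𝟙 y
𝟙-∧-+-≤ {true}  {true}  {z} _ = s≤s (𝟙≤1 z)
𝟙-∧-+-≤ {true}  {false} {z} _ = 𝟙≤1 z
𝟙-∧-+-≤ {false} {true}  {z} _ = 𝟙≤1 z
𝟙-∧-+-≤ {false} {false} {false} _ = z≤n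
𝟙-∧-+-≤ {false} {false} {true} z⇒x∨y with z⇒x∨y _
... | inj₁ ()
... | inj₂ ()

∑-mono-≤ : ∀ {n} {f g : Fin n → ℕ} → (∀ i → f i ≤ g i) → ∑[ i < n ] f i ≤ ∑[ i < n ] g i
∑-mono-≤ {zero}  f≤g = z≤n
∑-mono-≤ {suc n} f≤g = +-mono-≤ (f≤g zero) (∑-mono-≤ (f≤g ∘ suc))

∑∑-distrib-+ : ∀ {m n} (f g : Fin m → Fin n → ℕ) →
  ∑[ i < m ] ∑[ j < n ] (f i j + g i j) ≡ ∑[ i < m ] ∑[ j < n ] f i j + ∑[ i < m ] ∑[ j < n ] g i j
∑∑-distrib-+ {m} {n} f g =
  trans (sum-cong-≗ λ i → ∑-distrib-+ {n} (f i) (g i)) (∑-distrib-+ {m} (λ i → ∑[ j < n ] f i j) _)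

∑-≥-term : ∀ {n} (f : Fin n → ℕ) i → f i ≤ ∑[ j < n ] f j
∑-≥-term {suc n} f i rewrite sum-remove {i = i} f = m≤m+n (f i) _

∑-≥-two-terms : ∀ {n} (f : Fin n → ℕ) {i j} → i ≢ j → f i + f j ≤ ∑[ k < n ] f k
∑-≥-two-terms {suc n} f {i} {j} i≢j rewrite sum-remove {i = i} f =
  +-mono-≤ ≤-refl (subst (_≤ sum (removeAt f i)) (cong f (punchIn-punchOut i≢j)) (∑-≥-term (removeAt f i) (punchOut i≢j)))

∑-if-≟ : ∀ {n} (w : Fin n) (f : Fin n → ℕ) → ∑[ i < n ] (if does (i ≟ w) then f i else 0) ≡ f w
∑-if-≟ {suc n} zero    f = trans (cong (f zero +_) (sum-replicate-zero n)) (+-identityʳ (f zero))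
∑-if-≟ {suc n} (suc w) f = ∑-if-≟ w (f ∘ suc)

∑∑-if-row : ∀ {m n} (w : Fin m) (f : Fin m → Fin n → ℕ) →
  ∑[ i < m ] ∑[ j < n ] (if does (i ≟ w) then f i j else 0) ≡ ∑[ j < n ] f w j
∑∑-if-row {m} {n} w f = trans (∑-comm {m} {n} _) (sum-cong-≗ λ j → ∑-if-≟ w (λ i → f i j))

∑∑-if-column : ∀ {m n} (w : Fin n) (f : Fin m → Fin n → ℕ) →
  ∑[ i < m ] ∑[ j < n ] (if does (j ≟ w) then f i j else 0) ≡ ∑[ i < m ] f i w
∑∑-if-column w f = sum-cong-≗ λ i → ∑-if-≟ w (f i)

listSum-allFin : ∀ {n} (f : Fin n → ℕ) → listSum (map f (allFin n)) ≡ ∑[ i < n ] f i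
listSum-allFin {n} f = trans (cong listSum (map-tabulate {n = n} (λ i → i) f)) (listSum-tabulate f)
  where
  listSum-tabulate : ∀ {n} (f : Fin n → ℕ) → listSum (tabulate f) ≡ ∑[ i < n ] f i
  listSum-tabulate {zero}  f = refl
  listSum-tabulate {suc n} f = cong (f zero +_) (listSum-tabulate (f ∘ suc))

degree : ∀ {n} → Adj n → Fin n → ℕ
degree {n} g i = ∑[ j < n ] 𝟙 (g i j)

degreeSum : ∀ {n} → Adj n → ℕ
degreeSum {n} g = ∑[ i < n ] degree g i

deleteVertex : ∀ {n} → Adj (suc n) → Fin (suc n) → Adj n
deleteVertex g u a b = g (punchIn u a) (punchIn u b)

module _ {n} {g : Adj n} (simple : IsSimple g) where
  open IsSimple simple

  degreeSum≡2*numEdges : degreeSum g ≡ 2 * numEdges g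
  degreeSum≡2*numEdges = begin
    degreeSum g                                ≡⟨ sum-cong-≗ (λ i → sum-cong-≗ (split i)) ⟩
    ∑[ i < n ] ∑[ j < n ] (up i j + up j i)    ≡⟨ ∑∑-distrib-+ up (λ i j → up j i) ⟩
    ∑∑up + ∑[ i < n ] ∑[ j < n ] up j i        ≡⟨ cong (∑∑up +_) (∑-comm {n} {n} (λ i j → up j i)) ⟩
    ∑∑up + ∑∑up                                ≡⟨ cong (λ e → e + e) ∑∑up≡numEdges ⟩
    numEdges g + numEdges g                    ≡⟨ cong (numEdges g +_) (sym (+-identityʳ _)) ⟩
    2 * numEdges g                             ∎
    where
    open ≡-Reasoning
    up : Fin n → Fin n → ℕ
    up i j = 𝟙 ((toℕ i <ᵇ toℕ j) ∧ g i j)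
    ∑∑up : ℕ
    ∑∑up = ∑[ i < n ] ∑[ j < n ] up i j
    ∑∑up≡numEdges : ∑∑up ≡ numEdges g
    ∑∑up≡numEdges = sym (trans (listSum-allFin {n} _) (sum-cong-≗ {n} λ i → listSum-allFin (up i)))
    split : ∀ i j → 𝟙 (g i j) ≡ up i j + up j i
    split i j with toℕ i <ᵇ toℕ j in i<j | toℕ j <ᵇ toℕ i in j<i
    ... | true  | true  = ⊥-elim (<-asym (<ᵇ⇒< (toℕ i) (toℕ j) (Equivalence.from T-≡ i<j))
                                         (<ᵇ⇒< (toℕ j) (toℕ i) (Equivalence.from T-≡ j<i)))
    ... | true  | false = sym (+-identityʳ _)
    ... | false | true  = cong 𝟙 (symmetric i j)
    ... | false | false = cong 𝟙 (subst (λ k → g i k ≡ false) i≡j (irreflexive i))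
      where
      i≡j : i ≡ j
      i≡j = toℕ-injective (≤-antisym (≮⇒≥ (subst T j<i ∘ <⇒<ᵇ)) (≮⇒≥ (subst T i<j ∘ <⇒<ᵇ)))

module _ {n} {g : Adj (suc n)} (simple : IsSimple g) (u : Fin (suc n)) where
  open IsSimple simple

  degree-punchIn : degree g u ≡ ∑[ b < n ] 𝟙 (g u (punchIn u b))
  degree-punchIn = trans (sum-remove {i = u} (λ j → 𝟙 (g u j)))
                         (cong (λ x → 𝟙 x + ∑[ b < n ] 𝟙 (g u (punchIn u b))) (irreflexive u))

  degreeSum-deleteVertex : degreeSum g ≡ degree g u + (degree g u + degreeSum (deleteVertex g u))
  degreeSum-deleteVertex = begin
    degreeSum g
      ≡⟨ sum-remove {i = u} (degree g) ⟩
    degree g u + ∑[ a < n ] degree g (punchIn u a)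
      ≡⟨ cong (degree g u +_) (sum-cong-≗ λ a → sum-remove {i = u} (λ j → 𝟙 (g (punchIn u a) j))) ⟩
    degree g u + ∑[ a < n ] (𝟙 (g (punchIn u a) u) + degree (deleteVertex g u) a)
      ≡⟨ cong (degree g u +_) (∑-distrib-+ {n} _ _) ⟩
    degree g u + (∑[ a < n ] 𝟙 (g (punchIn u a) u) + degreeSum (deleteVertex g u))
      ≡⟨ cong (λ d → degree g u + (d + degreeSum (deleteVertex g u))) column≡degree ⟩
    degree g u + (degree g u + degreeSum (deleteVertex g u))  ∎
    where
    open ≡-Reasoning
    column≡degree : ∑[ a < n ] 𝟙 (g (punchIn u a) u) ≡ degree g u
    column≡degree = trans (sum-cong-≗ λ a → cong 𝟙 (symmetric (punchIn u a) u)) (sym degree-punchIn)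

T-does⁻ : ∀ {a} {A : Set a} (a? : Dec A) → T (does a?) → A
T-does⁻ a? = toWitness ∘ subst T (sym (isYes≗does a?))

T-does⁺ : ∀ {a} {A : Set a} (a? : Dec A) → A → T (does a?)
T-does⁺ a? = subst T (isYes≗does a?) ∘ fromWitness

module ContractMap {m} (u v : Fin (suc m)) (u≢v : u ≢ v) where

  φ : Fin (suc m) → Fin m
  φ = contractMap u v u≢v

  uᵥ : Fin m
  uᵥ = punchOut u≢v

  punchIn-uᵥ : punchIn u uᵥ ≡ v
  punchIn-uᵥ = punchIn-punchOut u≢v

  contractMap-punchIn : ∀ a → φ (punchIn u a) ≡ a
  contractMap-punchIn a with u ≟ punchIn u a
  ... | yes u≡ = ⊥-elim (punchInᵢ≢i u a (sym u≡))
  ... | no u≢ = punchIn-injective u _ _ (punchIn-punchOut u≢)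

  punchIn-contractMap : ∀ {x} → x ≢ u → punchIn u (φ x) ≡ x
  punchIn-contractMap {x} x≢u with u ≟ x
  ... | yes u≡x = ⊥-elim (x≢u (sym u≡x))
  ... | no u≢x = punchIn-punchOut u≢x

  contractMap-fibre : ∀ {x a} → φ x ≡ a → x ≡ u ⊎ x ≡ punchIn u a
  contractMap-fibre {x} φx≡a with x ≟ u
  ... | yes x≡u = inj₁ x≡u
  ... | no x≢u = inj₂ (trans (sym (punchIn-contractMap x≢u)) (cong (punchIn u) φx≡a))

  Merged : Fin (suc m) → Set
  Merged x = x ≡ u ⊎ x ≡ v

  merged? : ∀ x → Dec (Merged x)
  merged? x = x ≟ u ⊎-dec x ≟ v

  contractMap-merged : ∀ {x} → Merged x → φ x ≡ uᵥ
  contractMap-merged (inj₁ refl) with u ≟ u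
  ... | yes _ = refl
  ... | no u≢u = ⊥-elim (u≢u refl)
  contractMap-merged (inj₂ refl) = trans (cong φ (sym punchIn-uᵥ)) (contractMap-punchIn uᵥ)

  contractMap-injectiveAt : ∀ {x y} → ¬ Merged x → φ x ≡ φ y → x ≡ y
  contractMap-injectiveAt {x} {y} x∉ φx≡φy with merged? y
  ... | no y∉ = begin
    x                ≡⟨ sym (punchIn-contractMap (x∉ ∘ inj₁)) ⟩
    punchIn u (φ x)  ≡⟨ cong (punchIn u) φx≡φy ⟩
    punchIn u (φ y)  ≡⟨ punchIn-contractMap (y∉ ∘ inj₁) ⟩
    y                ∎
    where open ≡-Reasoning
  ... | yes y∈ = ⊥-elim (x∉ (inj₂ (begin
    x                ≡⟨ sym (punchIn-contractMap (x∉ ∘ inj₁)) ⟩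
    punchIn u (φ x)  ≡⟨ cong (punchIn u) (trans φx≡φy (contractMap-merged y∈)) ⟩
    punchIn u uᵥ     ≡⟨ punchIn-uᵥ ⟩
    v                ∎)))
    where open ≡-Reasoning

  contractMap-≢ : ∀ {x y} → ¬ Merged x → x ≢ y → φ x ≢ φ y
  contractMap-≢ x∉ x≢y = x≢y ∘ contractMap-injectiveAt x∉

  Collapsed : Fin (suc m) → Fin (suc m) → Set
  Collapsed x y = (x ≡ u × y ≡ v) ⊎ (x ≡ v × y ≡ u)

  contractMap-collapses : ∀ {x y} → x ≢ y → φ x ≡ φ y → Collapsed x y
  contractMap-collapses {x} {y} x≢y φx≡φy with merged? x | merged? y
  ... | no x∉ | _ = ⊥-elim (contractMap-≢ x∉ x≢y φx≡φy)
  ... | yes _ | no y∉ = ⊥-elim (contractMap-≢ y∉ (x≢y ∘ sym) (sym φx≡φy))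
  ... | yes (inj₁ refl) | yes (inj₁ refl) = ⊥-elim (x≢y refl)
  ... | yes (inj₁ refl) | yes (inj₂ refl) = inj₁ (refl , refl)
  ... | yes (inj₂ refl) | yes (inj₁ refl) = inj₂ (refl , refl)
  ... | yes (inj₂ refl) | yes (inj₂ refl) = ⊥-elim (x≢y refl)

  collapsed-contractMap : ∀ {x y} → Collapsed x y → φ x ≡ φ y
  collapsed-contractMap (inj₁ (refl , refl)) =
    trans (contractMap-merged (inj₁ refl)) (sym (contractMap-merged (inj₂ refl)))
  collapsed-contractMap (inj₂ (refl , refl)) =
    trans (contractMap-merged (inj₂ refl)) (sym (contractMap-merged (inj₁ refl)))

  collapsed-unmerged : ∀ {x y w} → Collapsed x y → w ≢ x → w ≢ y → ¬ Merged w
  collapsed-unmerged (inj₁ (refl , refl)) w≢u w≢v = [ w≢u , w≢v ]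
  collapsed-unmerged (inj₂ (refl , refl)) w≢v w≢u = [ w≢u , w≢v ]

CommonNeighbour : ∀ {n} → Adj n → Fin n → Fin n → Fin n → Set
CommonNeighbour g a b w = Edge g a w × Edge g b w

TwoCommonNeighbours : ∀ {n} → Adj n → Fin n → Fin n → Set
TwoCommonNeighbours {n} g a b =
  Σ (Fin n) λ w₁ → Σ (Fin n) λ w₂ →
    w₁ ≢ w₂ × Edge g a w₁ × Edge g b w₁ × Edge g a w₂ × Edge g b w₂

twoCommonNeighbours : ∀ {n} {g : Adj n} {a b w₁ w₂} → w₁ ≢ w₂ →
  CommonNeighbour g a b w₁ → CommonNeighbour g a b w₂ → TwoCommonNeighbours g a b
twoCommonNeighbours w₁≢w₂ (aw₁ , bw₁) (aw₂ , bw₂) = _ , _ , w₁≢w₂ , aw₁ , bw₁ , aw₂ , bw₂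

twoCommonNeighbours-sym : ∀ {n} {g : Adj n} {a b} → TwoCommonNeighbours g a b → TwoCommonNeighbours g b a
twoCommonNeighbours-sym (w₁ , w₂ , w₁≢w₂ , aw₁ , bw₁ , aw₂ , bw₂) = w₁ , w₂ , w₁≢w₂ , bw₁ , aw₁ , bw₂ , aw₂

module Contraction {m} (adj : Adj (suc m)) (simple : IsSimple adj) (u v : Fin (suc m)) (u≢v : u ≢ v) where
  open IsSimple simple
  open ContractMap u v u≢v public

  adj·e : Adj m
  adj·e = contract adj u v u≢v

  Edge-sym : ∀ {x y} → Edge adj x y → Edge adj y x
  Edge-sym {x} {y} = subst T (symmetric x y)

  Edge⇒≢ : ∀ {x y} → Edge adj x y → x ≢ y
  Edge⇒≢ {x} xy refl = subst T (irreflexive x) xy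

  private
    preimage? : ∀ a b → Dec (∃₂ λ x y → T (does (φ x ≟ a) ∧ does (φ y ≟ b) ∧ adj x y))
    preimage? a b = any? λ x → any? λ y → T? (does (φ x ≟ a) ∧ does (φ y ≟ b) ∧ adj x y)

    lifts? : ∀ a b x y → Dec (φ x ≡ a × φ y ≡ b × Edge adj x y)
    lifts? a b x y = (φ x ≟ a) ×-dec (φ y ≟ b) ×-dec T? (adj x y)

  Edge-contract⁻ : ∀ {a b} → Edge adj·e a b → a ≢ b × ∃₂ λ x y → φ x ≡ a × φ y ≡ b × Edge adj x y
  Edge-contract⁻ {a} {b} ab with T-does⁻ (¬? (a ≟ b) ×-dec preimage? a b) ab
  ... | a≢b , x , y , found = a≢b , x , y , T-does⁻ (lifts? a b x y) found

  Edge-contract⁺ : ∀ {a b x y} → a ≢ b → φ x ≡ a → φ y ≡ b → Edge adj x y → Edge adj·e a b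
  Edge-contract⁺ {a} {b} {x} {y} a≢b φx≡a φy≡b xy =
    T-does⁺ (¬? (a ≟ b) ×-dec preimage? a b) (a≢b , x , y , T-does⁺ (lifts? a b x y) (φx≡a , φy≡b , xy))

  Edge-contract-sym : ∀ {a b} → Edge adj·e a b → Edge adj·e b a
  Edge-contract-sym ab with Edge-contract⁻ ab
  ... | a≢b , _ , _ , φx≡a , φy≡b , xy = Edge-contract⁺ (a≢b ∘ sym) φy≡b φx≡a (Edge-sym xy)

  contract-isSimple : IsSimple adj·e
  contract-isSimple = record
    { symmetric   = λ a b → ⇔→≡ {z = true} (mk⇔ (swapped a b) (swapped b a))
    ; irreflexive = λ a → cong (λ d → not d ∧ does (preimage? a a)) (dec-true (a ≟ a) refl)
    }
    where
    swapped : ∀ a b → adj·e a b ≡ true → adj·e b a ≡ true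
    swapped a b = Equivalence.to T-≡ ∘ Edge-contract-sym ∘ Equivalence.from T-≡

  contractWalk : ∀ {x y} → Walk adj x y → Walk adj·e (φ x) (φ y)
  contractWalk here = here
  contractWalk (step {i} {j} ij walk) with φ i ≟ φ j
  ... | yes φi≡φj rewrite φi≡φj = contractWalk walk
  ... | no φi≢φj = step (Edge-contract⁺ φi≢φj refl refl ij) (contractWalk walk)

  contract-connected : Connected adj → Connected adj·e
  contract-connected connected a b =
    subst₂ (Walk adj·e) (contractMap-punchIn a) (contractMap-punchIn b)
      (contractWalk (connected (punchIn u a) (punchIn u b)))

  module _ (uv : Edge adj u v) (noK4 : ¬ InK4 adj u v) (cover : Cover32 adj) where

    collapsed-K4-free : ∀ {x y s t} → Collapsed x y → s ≢ t →
      CommonNeighbour adj x y s → CommonNeighbour adj x y t → ¬ Edge adj s t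
    collapsed-K4-free (inj₁ (refl , refl)) s≢t (us , vs) (ut , vt) st =
      noK4 (_ , _ , s≢t , uv , us , ut , vs , vt , st)
    collapsed-K4-free (inj₂ (refl , refl)) s≢t (vs , us) (vt , ut) st =
      noK4 (_ , _ , s≢t , uv , us , ut , vs , vt , st)

    commonNeighbour-avoiding : ∀ {a b} → Edge adj a b → ∀ z → ∃ λ w → w ≢ z × CommonNeighbour adj a b w
    commonNeighbour-avoiding {a} {b} ab z with cover a b ab
    ... | w₁ , w₂ , w₁≢w₂ , aw₁ , bw₁ , aw₂ , bw₂ with w₁ ≟ z
    ... | yes refl = w₂ , w₁≢w₂ ∘ sym , aw₂ , bw₂
    ... | no w₁≢z = w₁ , w₁≢z , aw₁ , bw₁

    commonNeighbour-contract : ∀ {x y w} → φ w ≢ φ x → φ w ≢ φ y →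
      CommonNeighbour adj x y w → CommonNeighbour adj·e (φ x) (φ y) (φ w)
    commonNeighbour-contract φw≢φx φw≢φy (xw , yw) =
      Edge-contract⁺ (φw≢φx ∘ sym) refl refl xw , Edge-contract⁺ (φw≢φy ∘ sym) refl refl yw

    commonNeighbours-contract-≢ : ∀ {x y w₁ w₂} → Edge adj x y → w₁ ≢ w₂ →
      CommonNeighbour adj x y w₁ → CommonNeighbour adj x y w₂ → φ w₁ ≢ φ w₂
    commonNeighbours-contract-≢ xy w₁≢w₂ (xw₁ , yw₁) (xw₂ , yw₂) φw₁≡φw₂ =
      collapsed-K4-free (contractMap-collapses w₁≢w₂ φw₁≡φw₂) (Edge⇒≢ xy)
        (Edge-sym xw₁ , Edge-sym xw₂) (Edge-sym yw₁ , Edge-sym yw₂) xy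

    cover-contract-partner : ∀ {x x̄ y w} → Collapsed x x̄ → Edge adj x y → Edge adj x̄ y → ¬ Merged y →
      CommonNeighbour adj x y w → φ w ≢ φ x → TwoCommonNeighbours adj·e (φ x) (φ y)
    cover-contract-partner {x} {x̄} {y} {w} xx̄ xy x̄y y∉ (xw , yw) φw≢φx
      with commonNeighbour-avoiding x̄y x
    ... | w′ , w′≢x , x̄w′ , yw′ =
      twoCommonNeighbours {g = adj·e} distinct
        (subst (λ a → CommonNeighbour adj·e a (φ y) (φ w′)) (sym (collapsed-contractMap xx̄))
          (commonNeighbour-contract (contractMap-≢ w′∉ w′≢x̄) (contractMap-≢ w′∉ (Edge⇒≢ yw′ ∘ sym))
            (x̄w′ , yw′)))
        (commonNeighbour-contract φw≢φx (contractMap-≢ y∉ (Edge⇒≢ yw) ∘ sym) (xw , yw))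
      where
      w′≢x̄ : w′ ≢ x̄
      w′≢x̄ = Edge⇒≢ x̄w′ ∘ sym
      w′∉ : ¬ Merged w′
      w′∉ = collapsed-unmerged xx̄ w′≢x w′≢x̄
      distinct : φ w′ ≢ φ w
      distinct φw′≡φw with contractMap-injectiveAt w′∉ φw′≡φw
      ... | refl = collapsed-K4-free xx̄ (Edge⇒≢ yw) (xy , x̄y) (xw , x̄w′) yw

    cover-contract : ∀ {x y} → Edge adj x y → ¬ Merged y → TwoCommonNeighbours adj·e (φ x) (φ y)
    cover-contract {x} {y} xy y∉ with cover x y xy
    ... | w₁ , w₂ , w₁≢w₂ , xw₁ , yw₁ , xw₂ , yw₂ with φ w₁ ≟ φ x | φ w₂ ≟ φ x
    ... | no φw₁≢φx | no φw₂≢φx =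
      twoCommonNeighbours {g = adj·e} (commonNeighbours-contract-≢ xy w₁≢w₂ (xw₁ , yw₁) (xw₂ , yw₂))
        (commonNeighbour-contract φw₁≢φx (contractMap-≢ y∉ (Edge⇒≢ yw₁) ∘ sym) (xw₁ , yw₁))
        (commonNeighbour-contract φw₂≢φx (contractMap-≢ y∉ (Edge⇒≢ yw₂) ∘ sym) (xw₂ , yw₂))
    ... | yes φw₁≡φx | _ =
      cover-contract-partner (contractMap-collapses (Edge⇒≢ xw₁) (sym φw₁≡φx)) xy (Edge-sym yw₁) y∉ (xw₂ , yw₂)
        (λ φw₂≡φx → commonNeighbours-contract-≢ xy w₁≢w₂ (xw₁ , yw₁) (xw₂ , yw₂) (trans φw₁≡φx (sym φw₂≡φx)))
    ... | no φw₁≢φx | yes φw₂≡φx =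
      cover-contract-partner (contractMap-collapses (Edge⇒≢ xw₂) (sym φw₂≡φx)) xy (Edge-sym yw₂) y∉ (xw₁ , yw₁) φw₁≢φx

    contract-cover32 : Cover32 adj·e
    contract-cover32 a b ab with Edge-contract⁻ ab
    ... | a≢b , x , y , refl , refl , xy with merged? y | merged? x
    ... | no y∉ | _ = cover-contract xy y∉
    ... | yes _ | no x∉ = twoCommonNeighbours-sym {g = adj·e} (cover-contract (Edge-sym xy) x∉)
    ... | yes y∈ | yes x∈ = ⊥-elim (a≢b (trans (contractMap-merged x∈) (sym (contractMap-merged y∈))))

  module _ (uv : Edge adj u v) where

    isCommonNeighbour : Fin m → Bool
    isCommonNeighbour b = adj u (punchIn u b) ∧ adj v (punchIn u b)

    commonNeighbourCount : ℕ
    commonNeighbourCount = ∑[ b < m ] 𝟙 (isCommonNeighbour b)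

    Edge-contract-row : ∀ {b} → Edge adj·e uᵥ b → Edge adj u (punchIn u b) ⊎ Edge adj v (punchIn u b)
    Edge-contract-row ab with Edge-contract⁻ ab
    ... | uᵥ≢b , x , y , φx≡uᵥ , φy≡b , xy with contractMap-fibre φx≡uᵥ | contractMap-fibre φy≡b
    ... | _         | inj₁ refl = ⊥-elim (uᵥ≢b (trans (sym (contractMap-merged (inj₁ refl))) φy≡b))
    ... | inj₁ refl | inj₂ refl = inj₁ xy
    ... | inj₂ refl | inj₂ refl = inj₂ (subst (λ z → Edge adj z _) punchIn-uᵥ xy)

    Edge-contract-off : ∀ {a b} → a ≢ uᵥ → b ≢ uᵥ → Edge adj·e a b → Edge (deleteVertex adj u) a b
    Edge-contract-off a≢uᵥ b≢uᵥ ab with Edge-contract⁻ ab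
    ... | _ , x , y , φx≡a , φy≡b , xy with contractMap-fibre φx≡a | contractMap-fibre φy≡b
    ... | inj₁ refl | _         = ⊥-elim (a≢uᵥ (trans (sym φx≡a) (contractMap-merged (inj₁ refl))))
    ... | inj₂ _    | inj₁ refl = ⊥-elim (b≢uᵥ (trans (sym φy≡b) (contractMap-merged (inj₁ refl))))
    ... | inj₂ refl | inj₂ refl = xy

    atUᵥ : Fin m → ℕ → ℕ
    atUᵥ a k = if does (a ≟ uᵥ) then k else 0

    -- Row uᵥ of G.e is covered by the rows of u and v in G − u (Edge-contract-row); the extra
    -- terms in row and column uᵥ account for the overlap of these rows, the common neighbours,
    -- and for the edge uv.
    degreeSum-contract-entrywise : ∀ a b →
      atUᵥ a (atUᵥ b 2) + (atUᵥ a (𝟙 (isCommonNeighbour b)) + (atUᵥ b (𝟙 (isCommonNeighbour a)) + 𝟙 (adj·e a b)))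
      ≤ atUᵥ a (𝟙 (adj u (punchIn u b))) + (atUᵥ b (𝟙 (adj u (punchIn u a))) + 𝟙 (deleteVertex adj u a b))
    degreeSum-contract-entrywise a b with a ≟ uᵥ | b ≟ uᵥ
    ... | yes refl | yes refl
      rewrite punchIn-uᵥ | irreflexive v | Equivalence.to T-≡ uv | IsSimple.irreflexive contract-isSimple uᵥ
      = ≤-refl
    ... | yes refl | no _ rewrite punchIn-uᵥ = 𝟙-∧-+-≤ Edge-contract-row
    ... | no _ | yes refl rewrite punchIn-uᵥ | symmetric (punchIn u a) v =
      𝟙-∧-+-≤ (Edge-contract-row ∘ Edge-contract-sym)
    ... | no a≢uᵥ | no b≢uᵥ = 𝟙-mono (Edge-contract-off a≢uᵥ b≢uᵥ)

    degreeSum-contract : 2 + (commonNeighbourCount + (commonNeighbourCount + degreeSum adj·e)) ≤ degreeSum adj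
    degreeSum-contract = begin
      2 + (X + (X + degreeSum adj·e))
        ≡⟨ sym ∑∑-left ⟩
      ∑[ a < m ] ∑[ b < m ] (atUᵥ a (atUᵥ b 2) + (atUᵥ a (cn b) + (atUᵥ b (cn a) + 𝟙 (adj·e a b))))
        ≤⟨ ∑-mono-≤ (λ a → ∑-mono-≤ (degreeSum-contract-entrywise a)) ⟩
      ∑[ a < m ] ∑[ b < m ] (atUᵥ a (nu b) + (atUᵥ b (nu a) + 𝟙 (deleteVertex adj u a b)))
        ≡⟨ ∑∑-right ⟩
      d + (d + degreeSum (deleteVertex adj u))
        ≡⟨ cong (λ k → k + (k + degreeSum (deleteVertex adj u))) (sym (degree-punchIn simple u)) ⟩
      degree adj u + (degree adj u + degreeSum (deleteVertex adj u))
        ≡⟨ sym (degreeSum-deleteVertex simple u) ⟩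
      degreeSum adj ∎
      where
      open ≤-Reasoning
      X : ℕ
      X = commonNeighbourCount
      cn nu : Fin m → ℕ
      cn b = 𝟙 (isCommonNeighbour b)
      nu b = 𝟙 (adj u (punchIn u b))
      d : ℕ
      d = ∑[ b < m ] nu b
      ∑∑-left : ∑[ a < m ] ∑[ b < m ] (atUᵥ a (atUᵥ b 2) + (atUᵥ a (cn b) + (atUᵥ b (cn a) + 𝟙 (adj·e a b))))
              ≡ 2 + (X + (X + degreeSum adj·e))
      ∑∑-left = trans (∑∑-distrib-+ {m} {m} _ _) (cong₂ _+_ (trans (∑∑-if-row {m} {m} uᵥ _) (∑-if-≟ uᵥ _))
                  (trans (∑∑-distrib-+ {m} {m} _ _) (cong₂ _+_ (∑∑-if-row {m} {m} uᵥ _)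
                    (trans (∑∑-distrib-+ {m} {m} _ _) (cong (_+ degreeSum adj·e) (∑∑-if-column {m} {m} uᵥ _))))))
      ∑∑-right : ∑[ a < m ] ∑[ b < m ] (atUᵥ a (nu b) + (atUᵥ b (nu a) + 𝟙 (deleteVertex adj u a b)))
               ≡ d + (d + degreeSum (deleteVertex adj u))
      ∑∑-right = trans (∑∑-distrib-+ {m} {m} _ _) (cong₂ _+_ (∑∑-if-row {m} {m} uᵥ _)
                   (trans (∑∑-distrib-+ {m} {m} _ _)
                     (cong (_+ degreeSum (deleteVertex adj u)) (∑∑-if-column {m} {m} uᵥ _))))

    numEdges-contract : numEdges adj·e + (1 + commonNeighbourCount) ≤ numEdges adj
    numEdges-contract = *-cancelˡ-≤ 2 (begin
      2 * (e′ + (1 + X))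
        ≡⟨ solve 2 (λ e x → con 2 :* (e :+ (con 1 :+ x)) := con 2 :+ (x :+ (x :+ con 2 :* e))) refl e′ X ⟩
      2 + (X + (X + 2 * e′))
        ≡⟨ cong (λ s → 2 + (X + (X + s))) (sym (degreeSum≡2*numEdges contract-isSimple)) ⟩
      2 + (X + (X + degreeSum adj·e))
        ≤⟨ degreeSum-contract ⟩
      degreeSum adj
        ≡⟨ degreeSum≡2*numEdges simple ⟩
      2 * numEdges adj ∎)
      where
      open ≤-Reasoning
      open +-*-Solver
      e′ X : ℕ
      e′ = numEdges adj·e
      X = commonNeighbourCount

    commonNeighbourCount≥2 : Cover32 adj → 2 ≤ commonNeighbourCount
    commonNeighbourCount≥2 cover with cover u v uv
    ... | w₁ , w₂ , w₁≢w₂ , uw₁ , vw₁ , uw₂ , vw₂ =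
      ≤-trans (+-mono-≤ (counted uw₁ vw₁) (counted uw₂ vw₂))
              (∑-≥-two-terms (𝟙 ∘ isCommonNeighbour) (contractMap-≢ (unmerged uw₁ vw₁) w₁≢w₂))
      where
      unmerged : ∀ {w} → Edge adj u w → Edge adj v w → ¬ Merged w
      unmerged uw vw = [ Edge⇒≢ uw ∘ sym , Edge⇒≢ vw ∘ sym ]
      counted : ∀ {w} → Edge adj u w → Edge adj v w → 1 ≤ 𝟙 (isCommonNeighbour (φ w))
      counted uw vw = T⇒1≤𝟙 (subst (λ z → T (adj u z ∧ adj v z))
                                   (sym (punchIn-contractMap (Edge⇒≢ uw ∘ sym)))
                                   (Equivalence.from T-∧ (uw , vw)))

lemma3p2 : (m : ℕ) (adj : Adj (suc m)) → IsSimple adj → Connected adj → Cover32 adj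
    → 4 < suc m
    → (u v : Fin (suc m)) (u≢v : u ≢ v) → Edge adj u v → ¬ InK4 adj u v
    → IsSimple (contract adj u v u≢v) × Connected (contract adj u v u≢v)
      × Cover32 (contract adj u v u≢v)
      × numEdges (contract adj u v u≢v) + 3 ≤ numEdges adj
lemma3p2 m adj simple connected cover _ u v u≢v uv noK4 =
    contract-isSimple
  , contract-connected connected
  , contract-cover32 uv noK4 cover
  , ≤-trans (+-monoʳ-≤ (numEdges adj·e) (s≤s (commonNeighbourCount≥2 uv cover))) (numEdges-contract uv)
  where open Contraction adj simple u v u≢v
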